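{- Let $m\ge1$ and define $\binom{n}{k}_m$ for $0\le k\le n$ by $\binom{n}{0}_m=1$, $\binom{n}{n}_m=\delta_{n\bmod m,0}$ (for all $n\ge0$), and $\binom{n}{k}_m=\binom{n-1}{k}_m+\binom{n-1}{k-1}_m$ for $0<k<n$. Then $\binom{n}{n}_m=\delta_{n\bmod m,0}$ and, for $0\le k<n$, \[ \binom{n}{k}_m=\sum_{j=0}^{\lfloor k/m\rfloor}\binom{n-mj-1}{n-k-1}, \] where on the right the binomial coefficients are ordinary ones.
   Context: $\delta_{i,j}$ is $1$ if $i=j$ and $0$ otherwise. -}

module Defs where

open import Data.Nat using (ℕ; zero; suc; _+_; _*_; _∸_; _<ᵇ_; _≡ᵇ_; NonZero)
open import Data.Nat.DivMod using (_%_)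
open import Data.Bool using (if_then_else_)

δ₀ : ℕ → ℕ
δ₀ zero = 1
δ₀ (suc _) = 0

-- Values with k > n are set to 0 (outside the paper's domain; never used
-- by the recursion for 0<k<n).
mbinom : (m : ℕ) → .{{NonZero m}} → ℕ → ℕ → ℕ
mbinom m n zero = 1
mbinom m zero (suc k) = 0
mbinom m (suc n) (suc k) =
  if suc k ≡ᵇ suc n then δ₀ (suc n % m)
  else (if suc k <ᵇ suc n then mbinom m n (suc k) + mbinom m n k else 0)

sumTo : ℕ → (ℕ → ℕ) → ℕ
sumTo zero f = f 0
sumTo (suc N) f = sumTo N f + f (suc N)

{-# OPTIONS --safe #-}
-- Both sides obey Pascal's rule for 0 < k < n - 1: summand by summand the
-- ordinary rule applies, and the upper limit ⌊k/m⌋ only grows when m ∣ k + 1,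
-- where the new summand is a vanishing binomial coefficient. On the
-- subdiagonal every summand is C(·, 0) = 1, so the sum is ⌊k/m⌋ + 1, and the
-- diagonal term δ makes up the difference since ⌊(k+1)/m⌋ = δ_{(k+1) mod m,0} + ⌊k/m⌋.
module Submission where

open import Defs
open import Data.Nat using (ℕ; zero; suc; _+_; _*_; _∸_; _<_; _≤_; z≤n; s<s; NonZero; _≡ᵇ_; >-nonZero⁻¹)
open import Data.Nat.Properties
open import Data.Nat.DivMod
open import Data.Nat.Divisibility using (n∣m*n; m%n≡0⇒n∣m)
open import Data.Nat.Combinatorics using (_C_; nCn≡1; nCk+nC[k+1]≡[n+1]C[k+1]; k>n⇒nCk≡0)
open import Algebra.Properties.CommutativeSemigroup +-commutativeSemigroup using (interchange)
open import Data.Bool.Properties using (T-≡)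
open import Data.Product using (_×_; _,_)
open import Data.Sum using (inj₁; inj₂)
open import Data.Bool using (T; true; false)
open import Function.Bundles using (Equivalence)
open import Relation.Binary.PropositionalEquality
open import Relation.Nullary using (contradiction)
open ≡-Reasoning

sumTo-cong : ∀ N {f g : ℕ → ℕ} → (∀ j → j ≤ N → f j ≡ g j) → sumTo N f ≡ sumTo N g
sumTo-cong zero    f≗g = f≗g 0 z≤n
sumTo-cong (suc N) f≗g =
  cong₂ _+_ (sumTo-cong N (λ j j≤N → f≗g j (m≤n⇒m≤1+n j≤N))) (f≗g (suc N) ≤-refl)

sumTo-distrib-+ : ∀ N (f g : ℕ → ℕ) → sumTo N (λ j → f j + g j) ≡ sumTo N f + sumTo N g
sumTo-distrib-+ zero    f g = refl
sumTo-distrib-+ (suc N) f g = begin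
  sumTo N (λ j → f j + g j) + (f (suc N) + g (suc N))
    ≡⟨ cong (_+ (f (suc N) + g (suc N))) (sumTo-distrib-+ N f g) ⟩
  (sumTo N f + sumTo N g) + (f (suc N) + g (suc N))
    ≡⟨ interchange (sumTo N f) (sumTo N g) (f (suc N)) (g (suc N)) ⟩
  (sumTo N f + f (suc N)) + (sumTo N g + g (suc N)) ∎

sumTo-const : ∀ N c → sumTo N (λ _ → c) ≡ suc N * c
sumTo-const zero    c = sym (+-identityʳ c)
sumTo-const (suc N) c = trans (cong (_+ c) (sumTo-const N c)) (+-comm (suc N * c) c)

m∸n∸1≡m∸[1+n] : ∀ m n → m ∸ n ∸ 1 ≡ m ∸ suc n
m∸n∸1≡m∸[1+n] m n = trans (∸-+-assoc m n 1) (cong (m ∸_) (+-comm n 1))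

m<n⇒n∸m≡1+[n∸[1+m]] : ∀ {m n} → m < n → n ∸ m ≡ suc (n ∸ suc m)
m<n⇒n∸m≡1+[n∸[1+m]] {zero}  {suc n} _         = refl
m<n⇒n∸m≡1+[n∸[1+m]] {suc m} {suc n} (s<s m<n) = m<n⇒n∸m≡1+[n∸[1+m]] m<n

pascal-∸ : ∀ {n x y} → x < n → suc y < n →
  (suc n ∸ x ∸ 1) C (n ∸ y ∸ 1) ≡ (n ∸ x ∸ 1) C (n ∸ suc y ∸ 1) + (n ∸ x ∸ 1) C (n ∸ y ∸ 1)
pascal-∸ {n} {x} {y} x<n 1+y<n = begin
  (suc n ∸ x ∸ 1) C (n ∸ y ∸ 1)  ≡⟨ cong₂ _C_ 1+a-eq 1+b-eq ⟩
  suc a C suc b                  ≡⟨ nCk+nC[k+1]≡[n+1]C[k+1] a b ⟨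
  a C b + a C suc b              ≡⟨ cong₂ _+_ (cong₂ _C_ a-eq b-eq) (cong₂ _C_ a-eq 1+b-eq) ⟨
  (n ∸ x ∸ 1) C (n ∸ suc y ∸ 1) + (n ∸ x ∸ 1) C (n ∸ y ∸ 1) ∎
  where
  a b : ℕ
  a = n ∸ suc x
  b = n ∸ suc (suc y)
  a-eq : n ∸ x ∸ 1 ≡ a
  a-eq = m∸n∸1≡m∸[1+n] n x
  b-eq : n ∸ suc y ∸ 1 ≡ b
  b-eq = m∸n∸1≡m∸[1+n] n (suc y)
  1+a-eq : suc n ∸ x ∸ 1 ≡ suc a
  1+a-eq = trans (m∸n∸1≡m∸[1+n] (suc n) x) (m<n⇒n∸m≡1+[n∸[1+m]] x<n)
  1+b-eq : n ∸ y ∸ 1 ≡ suc b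
  1+b-eq = trans (m∸n∸1≡m∸[1+n] n y) (m<n⇒n∸m≡1+[n∸[1+m]] 1+y<n)

C-∸-vanishes : ∀ {n y} → suc y < n → (n ∸ suc y ∸ 1) C (n ∸ y ∸ 1) ≡ 0
C-∸-vanishes {n} {y} 1+y<n = begin
  (n ∸ suc y ∸ 1) C (n ∸ y ∸ 1)    ≡⟨ cong₂ _C_ (m∸n∸1≡m∸[1+n] n (suc y)) shift ⟩
  b C suc b                        ≡⟨ k>n⇒nCk≡0 (n<1+n b) ⟩
  0                                ∎
  where
  b : ℕ
  b = n ∸ suc (suc y)
  shift : n ∸ y ∸ 1 ≡ suc b
  shift = trans (m∸n∸1≡m∸[1+n] n y) (m<n⇒n∸m≡1+[n∸[1+m]] 1+y<n)

module _ (m : ℕ) .{{_ : NonZero m}} where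

  1+r≤m⇒[1+r]/m≡δ₀[[1+r]%m] : ∀ {r} → suc r ≤ m → suc r / m ≡ δ₀ (suc r % m)
  1+r≤m⇒[1+r]/m≡δ₀[[1+r]%m] {r} 1+r≤m with m≤n⇒m<n∨m≡n 1+r≤m
  ... | inj₁ 1+r<m = trans (m<n⇒m/n≡0 1+r<m) (sym (cong δ₀ (m<n⇒m%n≡m 1+r<m)))
  ... | inj₂ 1+r≡m = trans (trans (/-congˡ 1+r≡m) (n/n≡1 m)) (sym (cong δ₀ (trans (%-congˡ 1+r≡m) (n%n≡0 m))))

  [1+k]/m≡δ₀[[1+k]%m]+k/m : ∀ k → suc k / m ≡ δ₀ (suc k % m) + k / m
  [1+k]/m≡δ₀[[1+k]%m]+k/m k = begin
    suc k / m                ≡⟨ /-congˡ split ⟩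
    (suc r + q * m) / m      ≡⟨ +-distrib-/-∣ʳ (suc r) (n∣m*n q) ⟩
    suc r / m + q * m / m    ≡⟨ cong₂ _+_ (1+r≤m⇒[1+r]/m≡δ₀[[1+r]%m] (m%n<n k m)) (m*n/n≡m q m) ⟩
    δ₀ (suc r % m) + q       ≡⟨ cong (λ i → δ₀ i + q) (trans (%-congˡ split) ([m+kn]%n≡m%n (suc r) q m)) ⟨
    δ₀ (suc k % m) + q       ∎
    where
    r q : ℕ
    r = k % m
    q = k / m
    split : suc k ≡ suc r + q * m
    split = cong suc (m≡m%n+[m/n]*n k m)

  j≤n/m⇒m*j≤n : ∀ {n j} → j ≤ n / m → m * j ≤ n
  j≤n/m⇒m*j≤n {n} j≤n/m = ≤-trans (*-monoʳ-≤ m j≤n/m) (subst (_≤ n) (*-comm (n / m) m) (m/n*n≤m n m))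

  -- Raising k by one adds the index j = 1 + k/m exactly when m ∣ 1 + k, and then m * j = 1 + k.
  sumTo-[1+k]/m : ∀ k (f : ℕ → ℕ) → (∀ j → m * j ≡ suc k → f j ≡ 0) →
    sumTo (suc k / m) f ≡ sumTo (k / m) f
  sumTo-[1+k]/m k f vanishes rewrite [1+k]/m≡δ₀[[1+k]%m]+k/m k with suc k % m in r≡0
  ... | suc _ = refl
  ... | zero  = trans (cong (sumTo (k / m) f +_) (vanishes (suc (k / m)) m*j≡1+k)) (+-identityʳ _)
    where
    m*j≡1+k : m * suc (k / m) ≡ suc k
    m*j≡1+k = begin
      m * suc (k / m)                    ≡⟨ cong (λ i → m * (δ₀ i + k / m)) r≡0 ⟨
      m * (δ₀ (suc k % m) + k / m)       ≡⟨ cong (m *_) ([1+k]/m≡δ₀[[1+k]%m]+k/m k) ⟨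
      m * (suc k / m)                    ≡⟨ m*[n/m]≡n (m%n≡0⇒n∣m (suc k) m r≡0) ⟩
      suc k                              ∎

  mbinomSum : ℕ → ℕ → ℕ
  mbinomSum n k = sumTo (k / m) (λ j → (n ∸ m * j ∸ 1) C (n ∸ k ∸ 1))

  mbinomSum-pascal : ∀ {n k} → suc k < n →
    mbinomSum (suc n) (suc k) ≡ mbinomSum n (suc k) + mbinomSum n k
  mbinomSum-pascal {n} {k} 1+k<n = begin
    mbinomSum (suc n) (suc k)
      ≡⟨ sumTo-cong (suc k / m) (λ j j≤ → pascal-∸ (≤-<-trans (j≤n/m⇒m*j≤n j≤) 1+k<n) 1+k<n) ⟩
    sumTo (suc k / m) (λ j → g j + f j)
      ≡⟨ sumTo-distrib-+ (suc k / m) g f ⟩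
    mbinomSum n (suc k) + sumTo (suc k / m) f
      ≡⟨ cong (mbinomSum n (suc k) +_) (sumTo-[1+k]/m k f vanishes) ⟩
    mbinomSum n (suc k) + mbinomSum n k ∎
    where
    f g : ℕ → ℕ
    f j = (n ∸ m * j ∸ 1) C (n ∸ k ∸ 1)
    g j = (n ∸ m * j ∸ 1) C (n ∸ suc k ∸ 1)
    vanishes : ∀ j → m * j ≡ suc k → f j ≡ 0
    vanishes j m*j≡1+k rewrite m*j≡1+k = C-∸-vanishes 1+k<n

  mbinomSum-subdiagonal : ∀ k → mbinomSum (suc k) k ≡ suc (k / m)
  mbinomSum-subdiagonal k = begin
    mbinomSum (suc k) k               ≡⟨ sumTo-cong (k / m) (λ j _ → cong ((suc k ∸ m * j ∸ 1) C_) bottom≡0) ⟩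
    sumTo (k / m) (λ _ → 1)           ≡⟨ sumTo-const (k / m) 1 ⟩
    suc (k / m) * 1                   ≡⟨ *-identityʳ _ ⟩
    suc (k / m)                       ∎
    where
    bottom≡0 : suc k ∸ k ∸ 1 ≡ 0
    bottom≡0 = trans (m∸n∸1≡m∸[1+n] (suc k) k) (n∸n≡0 k)

  mbinom-diagonal : ∀ n → mbinom m n n ≡ δ₀ (n % m)
  mbinom-diagonal zero    rewrite m<n⇒m%n≡m (>-nonZero⁻¹ m) = refl
  mbinom-diagonal (suc n) rewrite Equivalence.to T-≡ (≡⇒≡ᵇ n n refl) = refl

  mbinom-pascal : ∀ {n k} → k < n → mbinom m (suc n) (suc k) ≡ mbinom m n (suc k) + mbinom m n k
  mbinom-pascal {n} {k} k<n with k ≡ᵇ n in k≡ᵇn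
  ... | true  = contradiction (≡ᵇ⇒≡ k n (subst T (sym k≡ᵇn) _)) (<⇒≢ k<n)
  ... | false rewrite Equivalence.to T-≡ (<⇒<ᵇ k<n) = refl

  mbinom≡mbinomSum : ∀ n k → k < n → mbinom m n k ≡ mbinomSum n k
  mbinom≡mbinomSum (suc n) zero    _ = sym (begin
    mbinomSum (suc n) 0          ≡⟨ cong (λ N → sumTo N (λ j → (suc n ∸ m * j ∸ 1) C n)) (0/n≡0 m) ⟩
    (suc n ∸ m * 0 ∸ 1) C n      ≡⟨ cong (λ x → (suc n ∸ x ∸ 1) C n) (*-zeroʳ m) ⟩
    n C n                    ≡⟨ nCn≡1 n ⟩
    1                        ∎)
  mbinom≡mbinomSum (suc n) (suc k) (s<s k<n) with m≤n⇒m<n∨m≡n k<n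
  ... | inj₁ 1+k<n = begin
    mbinom m (suc n) (suc k)             ≡⟨ mbinom-pascal k<n ⟩
    mbinom m n (suc k) + mbinom m n k    ≡⟨ cong₂ _+_ (mbinom≡mbinomSum n (suc k) 1+k<n) (mbinom≡mbinomSum n k k<n) ⟩
    mbinomSum n (suc k) + mbinomSum n k  ≡⟨ mbinomSum-pascal 1+k<n ⟨
    mbinomSum (suc n) (suc k)            ∎
  ... | inj₂ refl = begin
    mbinom m (suc (suc k)) (suc k)                 ≡⟨ mbinom-pascal k<n ⟩
    mbinom m (suc k) (suc k) + mbinom m (suc k) k  ≡⟨ cong₂ _+_ (mbinom-diagonal (suc k)) (mbinom≡mbinomSum (suc k) k ≤-refl) ⟩
    δ₀ (suc k % m) + mbinomSum (suc k) k           ≡⟨ cong (δ₀ (suc k % m) +_) (mbinomSum-subdiagonal k) ⟩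
    δ₀ (suc k % m) + suc (k / m)                   ≡⟨ +-suc _ _ ⟩
    suc (δ₀ (suc k % m) + k / m)                   ≡⟨ cong suc ([1+k]/m≡δ₀[[1+k]%m]+k/m k) ⟨
    suc (suc k / m)                                ≡⟨ mbinomSum-subdiagonal (suc k) ⟨
    mbinomSum (suc (suc k)) (suc k)                ∎

corollary3 : (m : ℕ) → .{{_ : NonZero m}} →
    ((n : ℕ) → mbinom m n n ≡ δ₀ (n % m))
    × ((n k : ℕ) → k < n →
        mbinom m n k ≡ sumTo (k / m) (λ j → (n ∸ m * j ∸ 1) C (n ∸ k ∸ 1)))
corollary3 m = mbinom-diagonal m , mbinom≡mbinomSum m
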